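{- Let $F$ be a number field, $E/F$ a finite Galois extension with Galois group $\Gamma_{E/F}$, $S$ a (finite or infinite) set of places of $F$, $S_E$ the set of places of $E$ lying above places in $S$, and $\dot S_E\subset S_E$ a set consisting of exactly one place of $E$ above each $v\in S$. Assume that for every $\sigma\in\Gamma_{E/F}$ there exists $w\in\dot S_E$ with $\sigma w=w$. Then for every $\mathbb{Z}[\Gamma_{E/F}]$-module $Y$ we have \[ Y[S_E]_0 = Y[\dot S_E]_0 + I_{E/F}\big(Y[S_E]_0\big). \]
   Context: For a $\mathbb{Z}[\Gamma_{E/F}]$-module $Y$, $Y[S_E]_0$ denotes the group of finitely supported functions $f:S_E\to Y$ with $\sum_{w\in S_E}f(w)=0$, with $\Gamma_{E/F}$ acting by $(\sigma f)(w)=\sigma\big(f(\sigma^{ -1}w)\big)$ (equivalently $Y\otimes_{\mathbb{Z}}\mathbb{Z}[S_E]_0$ with diagonal action). $Y[\dot S_E]_0\subset Y[S_E]_0$ is the subgroup of those $f$ supported on $\dot S_E$. For a $\mathbb{Z}[\Gamma_{E/F}]$-module $M$, $I_{E/F}(M)=\sum_{\sigma\in\Gamma_{E/F}}(\sigma-1)(M)$. -}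

module Defs where

open import Level using (Level; _⊔_; suc)
open import Algebra.Bundles using (Group; AbelianGroup)
open import Data.List using (List; []; _∷_; map; foldr; _++_; concatMap)
open import Data.List.Relation.Unary.Any using (Any)
open import Data.List.Relation.Unary.All using (All)
open import Data.Product using (Σ; _×_; _,_; proj₁; proj₂; ∃; ∃-syntax)
open import Relation.Nullary using (¬_; yes; no)
open import Relation.Binary.Definitions using (DecidableEquality)
open import Relation.Binary.PropositionalEquality using (_≡_)

Finite : ∀ {c ℓ} (G : Group c ℓ) → Set (c ⊔ ℓ)
Finite G = Σ (List Carrier) λ l → ∀ g → Any (g ≈_) l
  where open Group G

record GSet {c ℓ} (G : Group c ℓ) (x : Level) : Set (c ⊔ ℓ ⊔ suc x) where
  open Group G
  field
    Pt      : Set x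
    _≟_     : DecidableEquality Pt
    act     : Carrier → Pt → Pt
    act-cong : ∀ {g h} p → g ≈ h → act g p ≡ act h p
    act-ε   : ∀ p → act ε p ≡ p
    act-∙   : ∀ g h p → act (g ∙ h) p ≡ act g (act h p)

record GModule {c ℓ} (G : Group c ℓ) (a b : Level) : Set (c ⊔ ℓ ⊔ suc (a ⊔ b)) where
  module G = Group G
  field
    Ab : AbelianGroup a b
  open AbelianGroup Ab public
  field
    act      : G.Carrier → Carrier → Carrier
    act-cong : ∀ {g h y z} → g G.≈ h → y ≈ z → act g y ≈ act h z
    act-ε    : ∀ y → act G.ε y ≈ y
    act-∙    : ∀ g h y → act (g G.∙ h) y ≈ act g (act h y)
    act-+    : ∀ g y z → act g (y ∙ z) ≈ act g y ∙ act g z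

module _ {c ℓ x a b} {G : Group c ℓ} (X : GSet G x) (Y : GModule G a b) where
  private
    module X = GSet X
    module Y = GModule Y
  open Group G using (Carrier)

  -- Finitely supported functions X → Y, presented as formal finite sums
  -- Σ y_i · [w_i] (a list of pairs (w_i , y_i)).
  FS : Set (x ⊔ a)
  FS = List (X.Pt × Y.Carrier)

  eval : FS → X.Pt → Y.Carrier
  eval [] w = Y.ε
  eval ((v , y) ∷ f) w with v X.≟ w
  ... | yes _ = y Y.∙ eval f w
  ... | no  _ = eval f w

  _≐_ : FS → FS → Set (x ⊔ b)
  f ≐ g = ∀ w → eval f w Y.≈ eval g w

  total : FS → Y.Carrier
  total = foldr (λ p s → proj₂ p Y.∙ s) Y.ε

  InY0 : FS → Set b
  InY0 f = total f Y.≈ Y.ε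

  SupportedOn : ∀ {d} → (X.Pt → Set d) → FS → Set (x ⊔ d ⊔ b)
  SupportedOn D f = ∀ w → ¬ D w → eval f w Y.≈ Y.ε

  -- Γ-action on formal sums: σ·(y[w]) = (σy)[σw], i.e. (σf)(w) = σ(f(σ⁻¹w)).
  actFS : Carrier → FS → FS
  actFS σ = map (λ p → X.act σ (proj₁ p) , Y.act σ (proj₂ p))

  negFS : FS → FS
  negFS = map (λ p → proj₁ p , Y._⁻¹ (proj₂ p))

  augFS : Carrier → FS → FS
  augFS σ f = actFS σ f ++ negFS f

  -- A general element of I_{E/F}(Y[S_E]_0) = Σ_σ (σ-1)(Y[S_E]_0):
  -- a finite sum Σ_i (σ_i - 1) m_i with every m_i ∈ Y[S_E]_0.
  IElt : List (Carrier × FS) → FS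
  IElt = concatMap (λ t → augFS (proj₁ t) (proj₂ t))

  AllInY0 : List (Carrier × FS) → Set (c ⊔ x ⊔ a ⊔ b)
  AllInY0 = All (λ t → InY0 (proj₂ t))

  -- Y[S_E]_0 = Y[Ṡ_E]_0 + I(Y[S_E]_0), as an equality of subgroups of Y[S_E]:
  -- both inclusions.
  DecompEq : ∀ {d} → (X.Pt → Set d) → Set (c ⊔ x ⊔ a ⊔ b ⊔ d)
  DecompEq D =
    (∀ f → InY0 f →
       ∃[ g ] ∃[ ts ] (InY0 g × SupportedOn D g × AllInY0 ts × f ≐ (g ++ IElt ts)))
    × (∀ g ts → InY0 g → SupportedOn D g → AllInY0 ts → InY0 (g ++ IElt ts))

{-# OPTIONS --safe #-}
-- Each term y[w] of f is congruent modulo I(Y[S_E]_0) to an element supported on Ṡ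
-- with the same total: write w = σu with u ∈ Ṡ and choose w₀ ∈ Ṡ fixed by σ; for
-- z = σ⁻¹y the element m = z[u] − z[w₀] of Y[S_E]_0 satisfies
-- (σ − 1) m = y[w] − y[w₀] − m, so y[w] = (y[w₀] + m) + (σ − 1) m.  Summing over the
-- terms of f, the part supported on Ṡ has total Σ f, which is 0 when f ∈ Y[S_E]_0.
-- Conversely σ − 1 multiplies totals by σ − 1, so I(Y[S_E]_0) ⊆ Y[S_E]_0.
module Submission where

open import Defs
open import Level using (_⊔_)
open import Algebra.Bundles using (Group)
open import Data.Product using (_×_; ∃-syntax; _,_)
open import Data.List using ([]; _∷_; _++_; [_])
open import Data.List.Properties using (++-assoc; ++-identityʳ)
open import Data.List.Relation.Unary.All using ([]; _∷_)
open import Data.List.Relation.Unary.All.Properties using (++⁺)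
open import Relation.Nullary using (yes; no)
open import Relation.Binary.PropositionalEquality as ≡ using (_≡_)
open import Data.Empty using (⊥-elim)
open import Relation.Binary.Bundles using (Setoid)
import Relation.Binary.Reasoning.Setoid

module GModuleProperties {c ℓ a b} {Γ : Group c ℓ} (M : GModule Γ a b) where
  open GModule M
  open import Algebra.Properties.AbelianGroup Ab using (identityˡ-unique; inverseˡ-unique)

  act-preserves-ε : ∀ σ → act σ ε ≈ ε
  act-preserves-ε σ = identityˡ-unique _ _ (begin
      act σ ε ∙ act σ ε  ≈⟨ act-+ σ ε ε ⟨
      act σ (ε ∙ ε)      ≈⟨ act-cong G.refl (identityˡ ε) ⟩
      act σ ε            ∎)
    where open Relation.Binary.Reasoning.Setoid setoid

  act-⁻¹ : ∀ σ y → act σ (y ⁻¹) ≈ act σ y ⁻¹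
  act-⁻¹ σ y = inverseˡ-unique _ _
    (trans (sym (act-+ σ (y ⁻¹) y)) (trans (act-cong G.refl (inverseˡ y)) (act-preserves-ε σ)))

  act-act⁻¹ : ∀ σ y → act σ (act (σ G.⁻¹) y) ≈ y
  act-act⁻¹ σ y =
    trans (sym (act-∙ σ (σ G.⁻¹) y)) (trans (act-cong (G.inverseʳ σ) refl) (act-ε y))

module FormalSums {c ℓ x a b} {Γ : Group c ℓ} (SE : GSet Γ x) (Y : GModule Γ a b) where
  private
    module Γ = Group Γ
    module X = GSet SE
    module Y = GModule Y
  open Y using (_≈_; _∙_; _⁻¹; ε; refl; sym; trans; ∙-cong; ∙-congˡ; assoc;
                identityˡ; identityʳ; inverseʳ; ⁻¹-cong)
  open import Algebra.Properties.AbelianGroup Y.Ab using (ε⁻¹≈ε; ⁻¹-∙-comm; xyx⁻¹≈y)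
  open import Algebra.Properties.CommutativeSemigroup Y.commutativeSemigroup using (interchange)
  open GModuleProperties Y

  private
    Sum : Set (x ⊔ a)
    Sum = FS SE Y

    ⟦_⟧ : Sum → X.Pt → Y.Carrier
    ⟦_⟧ = eval SE Y

    ∑ : Sum → Y.Carrier
    ∑ = total SE Y

    infix 4 _≐′_
    _≐′_ : Sum → Sum → Set (x ⊔ b)
    _≐′_ = _≐_ SE Y

  ≐-setoid : Setoid (x ⊔ a) (x ⊔ b)
  ≐-setoid = record
    { Carrier       = Sum
    ; _≈_           = _≐′_
    ; isEquivalence = record
      { refl  = λ _ → refl
      ; sym   = λ f≐g v → sym (f≐g v)
      ; trans = λ f≐g g≐h v → trans (f≐g v) (g≐h v)
      }
    }

  module ≐-Reasoning = Relation.Binary.Reasoning.Setoid ≐-setoid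

  ∷-congʳ : ∀ {p y z f g} → y ≈ z → f ≐′ g → (p , y) ∷ f ≐′ (p , z) ∷ g
  ∷-congʳ {p} y≈z f≐g v with p X.≟ v
  ... | yes _ = ∙-cong y≈z (f≐g v)
  ... | no  _ = f≐g v

  eval-++ : ∀ f g v → ⟦ f ++ g ⟧ v ≈ ⟦ f ⟧ v ∙ ⟦ g ⟧ v
  eval-++ []            g v = sym (identityˡ _)
  eval-++ ((p , y) ∷ f) g v with p X.≟ v
  ... | yes _ = trans (∙-congˡ (eval-++ f g v)) (sym (assoc _ _ _))
  ... | no  _ = eval-++ f g v

  eval-negFS : ∀ f v → ⟦ negFS SE Y f ⟧ v ≈ ⟦ f ⟧ v ⁻¹
  eval-negFS []            v = sym ε⁻¹≈ε
  eval-negFS ((p , y) ∷ f) v with p X.≟ v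
  ... | yes _ = trans (∙-congˡ (eval-negFS f v)) (⁻¹-∙-comm y (⟦ f ⟧ v))
  ... | no  _ = eval-negFS f v

  ++-cong : ∀ {f f′ g g′} → f ≐′ f′ → g ≐′ g′ → f ++ g ≐′ f′ ++ g′
  ++-cong {f} {f′} {g} {g′} f≐f′ g≐g′ v = begin
    ⟦ f ++ g ⟧ v          ≈⟨ eval-++ f g v ⟩
    ⟦ f ⟧ v ∙ ⟦ g ⟧ v     ≈⟨ ∙-cong (f≐f′ v) (g≐g′ v) ⟩
    ⟦ f′ ⟧ v ∙ ⟦ g′ ⟧ v   ≈⟨ eval-++ f′ g′ v ⟨
    ⟦ f′ ++ g′ ⟧ v        ∎
    where open Relation.Binary.Reasoning.Setoid Y.setoid

  ++-interchange : ∀ f g h k → (f ++ g) ++ (h ++ k) ≐′ (f ++ h) ++ (g ++ k)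
  ++-interchange f g h k v = begin
    ⟦ (f ++ g) ++ (h ++ k) ⟧ v                  ≈⟨ eval-++ (f ++ g) (h ++ k) v ⟩
    ⟦ f ++ g ⟧ v ∙ ⟦ h ++ k ⟧ v                 ≈⟨ ∙-cong (eval-++ f g v) (eval-++ h k v) ⟩
    (⟦ f ⟧ v ∙ ⟦ g ⟧ v) ∙ (⟦ h ⟧ v ∙ ⟦ k ⟧ v)   ≈⟨ interchange _ _ _ _ ⟩
    (⟦ f ⟧ v ∙ ⟦ h ⟧ v) ∙ (⟦ g ⟧ v ∙ ⟦ k ⟧ v)   ≈⟨ ∙-cong (eval-++ f h v) (eval-++ g k v) ⟨
    ⟦ f ++ h ⟧ v ∙ ⟦ g ++ k ⟧ v                 ≈⟨ eval-++ (f ++ h) (g ++ k) v ⟨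
    ⟦ (f ++ h) ++ (g ++ k) ⟧ v                  ∎
    where open Relation.Binary.Reasoning.Setoid Y.setoid

  total-++ : ∀ f g → ∑ (f ++ g) ≈ ∑ f ∙ ∑ g
  total-++ []            g = sym (identityˡ _)
  total-++ ((p , y) ∷ f) g = trans (∙-congˡ (total-++ f g)) (sym (assoc _ _ _))

  total-actFS : ∀ σ f → ∑ (actFS SE Y σ f) ≈ Y.act σ (∑ f)
  total-actFS σ []            = sym (act-preserves-ε σ)
  total-actFS σ ((p , y) ∷ f) = trans (∙-congˡ (total-actFS σ f)) (sym (Y.act-+ σ y (∑ f)))

  total-negFS : ∀ f → ∑ (negFS SE Y f) ≈ ∑ f ⁻¹
  total-negFS []            = sym ε⁻¹≈ε
  total-negFS ((p , y) ∷ f) = trans (∙-congˡ (total-negFS f)) (⁻¹-∙-comm y (∑ f))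

  InY0-augFS : ∀ σ f → InY0 SE Y f → InY0 SE Y (augFS SE Y σ f)
  InY0-augFS σ f f₀ = begin
    ∑ (actFS SE Y σ f ++ negFS SE Y f)        ≈⟨ total-++ (actFS SE Y σ f) (negFS SE Y f) ⟩
    ∑ (actFS SE Y σ f) ∙ ∑ (negFS SE Y f)     ≈⟨ ∙-cong (total-actFS σ f) (total-negFS f) ⟩
    Y.act σ (∑ f) ∙ ∑ f ⁻¹                    ≈⟨ ∙-cong (Y.act-cong Γ.refl f₀) (⁻¹-cong f₀) ⟩
    Y.act σ ε ∙ ε ⁻¹                          ≈⟨ ∙-cong (act-preserves-ε σ) ε⁻¹≈ε ⟩
    ε ∙ ε                                     ≈⟨ identityˡ ε ⟩
    ε                                         ∎
    where open Relation.Binary.Reasoning.Setoid Y.setoid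

  InY0-++ : ∀ f g → InY0 SE Y f → InY0 SE Y g → InY0 SE Y (f ++ g)
  InY0-++ f g f₀ g₀ = trans (total-++ f g) (trans (∙-cong f₀ g₀) (identityˡ ε))

  IElt-++ : ∀ ts ts′ → IElt SE Y (ts ++ ts′) ≡ IElt SE Y ts ++ IElt SE Y ts′
  IElt-++ []             ts′ = ≡.refl
  IElt-++ ((σ , m) ∷ ts) ts′ = ≡.trans (≡.cong (augFS SE Y σ m ++_) (IElt-++ ts ts′))
                                       (≡.sym (++-assoc (augFS SE Y σ m) (IElt SE Y ts) (IElt SE Y ts′)))

  InY0-IElt : ∀ ts → AllInY0 SE Y ts → InY0 SE Y (IElt SE Y ts)
  InY0-IElt []             []         = refl
  InY0-IElt ((σ , m) ∷ ts) (m₀ ∷ ts₀) =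
    InY0-++ (augFS SE Y σ m) (IElt SE Y ts) (InY0-augFS σ m m₀) (InY0-IElt ts ts₀)

  InY0-++-IElt : ∀ g ts → InY0 SE Y g → AllInY0 SE Y ts → InY0 SE Y (g ++ IElt SE Y ts)
  InY0-++-IElt g ts g₀ ts₀ = InY0-++ g (IElt SE Y ts) g₀ (InY0-IElt ts ts₀)

  difference : X.Pt → X.Pt → Y.Carrier → Sum
  difference u w₀ z = (u , z) ∷ (w₀ , z ⁻¹) ∷ []

  InY0-difference : ∀ u w₀ z → InY0 SE Y (difference u w₀ z)
  InY0-difference u w₀ z = trans (∙-congˡ (identityʳ (z ⁻¹))) (inverseʳ z)

  actFS-difference : ∀ {σ u w w₀} y → w ≡ X.act σ u → X.act σ w₀ ≡ w₀ →
                     actFS SE Y σ (difference u w₀ (Y.act (σ Γ.⁻¹) y)) ≐′ [ (w , y) ] ++ negFS SE Y [ (w₀ , y) ]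
  actFS-difference {σ} y ≡.refl σw₀≡w₀ rewrite σw₀≡w₀ =
    ∷-congʳ (act-act⁻¹ σ y)
      (∷-congʳ (trans (act-⁻¹ σ _) (⁻¹-cong (act-act⁻¹ σ y))) (λ _ → refl))

  singleton-≐ : ∀ {σ u w w₀} y → w ≡ X.act σ u → X.act σ w₀ ≡ w₀ →
                let m = difference u w₀ (Y.act (σ Γ.⁻¹) y) in
                [ (w , y) ] ≐′ ((w₀ , y) ∷ m) ++ augFS SE Y σ m
  singleton-≐ {σ} {u} {w} {w₀} y w≡σu σw₀≡w₀ v = sym (begin
    ⟦ ([ (w₀ , y) ] ++ m) ++ (actFS SE Y σ m ++ negFS SE Y m) ⟧ v
      ≈⟨ eval-++ ([ (w₀ , y) ] ++ m) _ v ⟩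
    ⟦ [ (w₀ , y) ] ++ m ⟧ v ∙ ⟦ actFS SE Y σ m ++ negFS SE Y m ⟧ v
      ≈⟨ ∙-cong (eval-++ [ (w₀ , y) ] m v) (eval-++ (actFS SE Y σ m) (negFS SE Y m) v) ⟩
    (A ∙ M) ∙ (⟦ actFS SE Y σ m ⟧ v ∙ ⟦ negFS SE Y m ⟧ v)
      ≈⟨ ∙-congˡ (∙-cong moved (eval-negFS m v)) ⟩
    (A ∙ M) ∙ ((W ∙ A ⁻¹) ∙ M ⁻¹)
      ≈⟨ interchange A M (W ∙ A ⁻¹) (M ⁻¹) ⟩
    (A ∙ (W ∙ A ⁻¹)) ∙ (M ∙ M ⁻¹)
      ≈⟨ ∙-cong (trans (sym (assoc A W (A ⁻¹))) (xyx⁻¹≈y A W)) (inverseʳ M) ⟩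
    W ∙ ε
      ≈⟨ identityʳ W ⟩
    W ∎)
    where
    open Relation.Binary.Reasoning.Setoid Y.setoid
    m = difference u w₀ (Y.act (σ Γ.⁻¹) y)
    A = ⟦ [ (w₀ , y) ] ⟧ v
    M = ⟦ m ⟧ v
    W = ⟦ [ (w , y) ] ⟧ v
    moved : ⟦ actFS SE Y σ m ⟧ v ≈ W ∙ A ⁻¹
    moved = trans (actFS-difference y w≡σu σw₀≡w₀ v)
              (trans (eval-++ [ (w , y) ] _ v) (∙-congˡ (eval-negFS [ (w₀ , y) ] v)))

  module _ {d} (D : X.Pt → Set d) where

    []-supportedOn : SupportedOn SE Y D []
    []-supportedOn _ _ = refl

    ∷-supportedOn : ∀ {p y f} → D p → SupportedOn SE Y D f → SupportedOn SE Y D ((p , y) ∷ f)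
    ∷-supportedOn {p} Dp f-supp v ¬Dv with p X.≟ v
    ... | yes ≡.refl = ⊥-elim (¬Dv Dp)
    ... | no  _      = f-supp v ¬Dv

    ++-supportedOn : ∀ {f g} → SupportedOn SE Y D f → SupportedOn SE Y D g → SupportedOn SE Y D (f ++ g)
    ++-supportedOn {f} {g} f-supp g-supp v ¬Dv =
      trans (eval-++ f g v) (trans (∙-cong (f-supp v ¬Dv) (g-supp v ¬Dv)) (identityˡ ε))

    Decomposition : Sum → Set (c ⊔ x ⊔ a ⊔ b ⊔ d)
    Decomposition f = ∃[ g ] ∃[ ts ]
      (∑ g ≈ ∑ f × SupportedOn SE Y D g × AllInY0 SE Y ts × f ≐′ g ++ IElt SE Y ts)

    decomposition-[] : Decomposition []
    decomposition-[] = [] , [] , refl , []-supportedOn , [] , λ _ → refl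

    decomposition-++ : ∀ {f f′} → Decomposition f → Decomposition f′ → Decomposition (f ++ f′)
    decomposition-++ {f} {f′} (g , ts , ∑g , g-supp , ts₀ , f≐) (g′ , ts′ , ∑g′ , g′-supp , ts′₀ , f′≐) =
      g ++ g′ , ts ++ ts′ ,
      trans (total-++ g g′) (trans (∙-cong ∑g ∑g′) (sym (total-++ f f′))) ,
      ++-supportedOn {g} {g′} g-supp g′-supp , ++⁺ ts₀ ts′₀ ,
      (begin
        f ++ f′                                       ≈⟨ ++-cong {f} {g ++ IElt SE Y ts} {f′} {g′ ++ IElt SE Y ts′} f≐ f′≐ ⟩
        (g ++ IElt SE Y ts) ++ (g′ ++ IElt SE Y ts′)  ≈⟨ ++-interchange g (IElt SE Y ts) g′ (IElt SE Y ts′) ⟩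
        (g ++ g′) ++ (IElt SE Y ts ++ IElt SE Y ts′)  ≡⟨ ≡.cong ((g ++ g′) ++_) (IElt-++ ts ts′) ⟨
        (g ++ g′) ++ IElt SE Y (ts ++ ts′)            ∎)
      where open ≐-Reasoning

    module _ (orbit-rep : ∀ w → ∃[ σ ] ∃[ u ] (D u × w ≡ X.act σ u))
             (has-fixed : ∀ σ → ∃[ w ] (D w × X.act σ w ≡ w)) where

      decomposition-singleton : ∀ w y → Decomposition [ (w , y) ]
      decomposition-singleton w y with orbit-rep w
      ... | σ , u , Du , w≡σu with has-fixed σ
      ... | w₀ , Dw₀ , σw₀≡w₀ =
        (w₀ , y) ∷ m , [ (σ , m) ] ,
        ∙-congˡ (InY0-difference u w₀ z) ,
        ∷-supportedOn Dw₀ (∷-supportedOn Du (∷-supportedOn Dw₀ []-supportedOn)) ,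
        InY0-difference u w₀ z ∷ [] ,
        (begin
          [ (w , y) ]                               ≈⟨ singleton-≐ y w≡σu σw₀≡w₀ ⟩
          ((w₀ , y) ∷ m) ++ augFS SE Y σ m          ≡⟨ ≡.cong (((w₀ , y) ∷ m) ++_) (++-identityʳ (augFS SE Y σ m)) ⟨
          ((w₀ , y) ∷ m) ++ IElt SE Y [ (σ , m) ]   ∎)
        where
        open ≐-Reasoning
        z = Y.act (σ Γ.⁻¹) y
        m = difference u w₀ z

      decompose : ∀ f → Decomposition f
      decompose []            = decomposition-[]
      decompose ((w , y) ∷ f) =
        decomposition-++ {[ (w , y) ]} {f} (decomposition-singleton w y) (decompose f)

      decompose-InY0 : ∀ f → InY0 SE Y f →
        ∃[ g ] ∃[ ts ] (InY0 SE Y g × SupportedOn SE Y D g × AllInY0 SE Y ts × f ≐′ g ++ IElt SE Y ts)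
      decompose-InY0 f f₀ with decompose f
      ... | g , ts , ∑g , g-supp , ts₀ , f≐ = g , ts , trans ∑g f₀ , g-supp , ts₀ , f≐

lemma2p4 : ∀ {c ℓ x d a b} (Γ : Group c ℓ) → Finite Γ →
           (SE : GSet Γ x) →
           (Ṡ : GSet.Pt SE → Set d) →
           (∀ w → ∃[ σ ] ∃[ u ] (Ṡ u × w ≡ GSet.act SE σ u)) →
           (∀ u u' σ → Ṡ u → Ṡ u' → u' ≡ GSet.act SE σ u → u' ≡ u) →
           (∀ σ → ∃[ w ] (Ṡ w × GSet.act SE σ w ≡ w)) →
           (Y : GModule Γ a b) →
           DecompEq SE Y Ṡ
lemma2p4 Γ _ SE Ṡ orbit-rep _ has-fixed Y =
  decompose-InY0 Ṡ orbit-rep has-fixed ,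
  λ g ts g₀ _ ts₀ → InY0-++-IElt g ts g₀ ts₀
  where open FormalSums SE Y
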